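{- Let $M$ be a finite abelian group of order $m$ and $J$ a Jacobi function on $M$, and suppose there is a bijection $i\colon\hat{M}\to\hat{M}$ with $i(x)=x\,i(x^{ -1})$ for all $x\in\hat{M}$ and $J(\alpha,\beta)=\frac{1}{m}\sum_{x\in\hat{M}}\alpha(i(x))\beta(i(x)x^{ -1})$ for all $\alpha,\beta\in M$. Then $M$ is the trivial group.
   Context: $\hat{M}$ is the Pontryagin dual of $M$ (written multiplicatively), and $\alpha(x)$ is the pairing of $\alpha\in M$ with $x\in\hat{M}$. $\delta(\alpha)=1$ if $\alpha$ is the identity of $M$, else $0$. A Jacobi function on $M$ is a function $J \colon M\times M \to \mathbf{C}$ satisfying: (A) $J(\alpha,\beta)=J(\beta,\alpha)$; (B) with $J^*(\alpha,\beta)=J(\alpha,\beta)-\delta(\alpha)-\delta(\beta)$, $J^*(\alpha,\beta)J^*(\alpha\beta,\gamma)=J^*(\alpha,\beta\gamma)J^*(\beta,\gamma)$ for all $\alpha,\beta,\gamma$; (C) $\sum_{\beta\in M} J(\alpha_1\beta,\alpha_2\beta^{ -1})J(\alpha_3\beta,\alpha_4\beta^{ -1}) = J(\alpha_1\alpha_4,\alpha_2\alpha_3)$ for all $\alpha_1,\dots,\alpha_4 \in M$. -}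

module Defs where

open import Level using (Level; _⊔_) renaming (suc to lsuc; zero to lzero)
open import Data.Nat using (ℕ; zero; suc)
open import Data.Fin using (Fin)
import Data.Fin as Fin
open import Data.List using (List; []; _∷_; _++_)
open import Data.Product using (Σ; ∃; _×_; _,_)
open import Relation.Nullary using (¬_; Dec; yes; no)
open import Relation.Binary.PropositionalEquality using (_≡_; refl; cong; sym; trans)
open import Algebra.Bundles using (CommutativeRing)
open import Algebra.Structures using (IsAbelianGroup)
open import Function.Bundles using (_↔_; Inverse)

record Field (c ℓ : Level) : Set (lsuc (c ⊔ ℓ)) where
  field
    commutativeRing : CommutativeRing c ℓ
  open CommutativeRing commutativeRing public
  field
    1≉0     : ¬ (1# ≈ 0#)
    inverse : ∀ x → ¬ (x ≈ 0#) → ∃ λ y → (x * y) ≈ 1#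

module _ {c ℓ : Level} (K : Field c ℓ) where
  open Field K

  fromℕ : ℕ → Carrier
  fromℕ zero    = 0#
  fromℕ (suc n) = 1# + fromℕ n

  HasCharZero : Set ℓ
  HasCharZero = ∀ n → ¬ (fromℕ (suc n) ≈ 0#)

  -- polynomial given by its coefficient list, constant term first (Horner)
  evalPoly : List Carrier → Carrier → Carrier
  evalPoly []       x = 0#
  evalPoly (a ∷ as) x = a + x * evalPoly as x

  -- every polynomial a + a₁x + … + c xⁿ with n ≥ 1 and c ≉ 0 has a root
  IsAlgClosed : Set (c ⊔ ℓ)
  IsAlgClosed = ∀ (a : Carrier) (as : List Carrier) (lc : Carrier) →
    ¬ (lc ≈ 0#) → ∃ λ x → evalPoly (a ∷ (as ++ (lc ∷ []))) x ≈ 0#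

  sumFin : (n : ℕ) → (Fin n → Carrier) → Carrier
  sumFin zero    f = 0#
  sumFin (suc n) f = f Fin.zero + sumFin n (λ i → f (Fin.suc i))

record FinAbGroup : Set₁ where
  infixl 7 _∙_
  field
    Carrier        : Set
    _∙_            : Carrier → Carrier → Carrier
    ε              : Carrier
    _⁻¹            : Carrier → Carrier
    isAbelianGroup : IsAbelianGroup _≡_ _∙_ ε _⁻¹
    order          : ℕ
    enum           : Fin order ↔ Carrier

  _≟_ : (x y : Carrier) → Dec (x ≡ y)
  x ≟ y with Inverse.from enum x Fin.≟ Inverse.from enum y
  ... | yes p = yes (trans (sym (Inverse.inverseˡ enum refl))
                     (trans (cong (Inverse.to enum) p) (Inverse.inverseˡ enum refl)))
  ... | no ¬p = no (λ q → ¬p (cong (Inverse.from enum) q))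

open FinAbGroup using (Carrier)

module _ {c ℓ : Level} (K : Field c ℓ) where
  open Field K renaming (Carrier to K₀)

  sumG : (G : FinAbGroup) → (Carrier G → K₀) → K₀
  sumG G f = sumFin K (FinAbGroup.order G) (λ i → f (Inverse.to (FinAbGroup.enum G) i))

  -- D (with pairing χ, χ α x = "α(x)") is the dual of M with respect to K:
  -- χ is bimultiplicative, and every homomorphism M → K^× is of the form
  -- α ↦ χ α x for exactly one x ∈ D.  For K = ℂ this is the Pontryagin
  -- dual of the finite group M (with M̂ = D).
  record IsDual (M D : FinAbGroup) (χ : Carrier M → Carrier D → K₀) : Set (c ⊔ ℓ) where
    module M = FinAbGroup M
    module D = FinAbGroup D
    field
      mult-M  : ∀ α β x → χ (α M.∙ β) x ≈ χ α x * χ β x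
      mult-D  : ∀ α x y → χ α (x D.∙ y) ≈ χ α x * χ α y
      unit-M  : ∀ x → χ M.ε x ≈ 1#
      unit-D  : ∀ α → χ α D.ε ≈ 1#
      surj    : ∀ (f : Carrier M → K₀) →
                  (∀ α β → f (α M.∙ β) ≈ f α * f β) → f M.ε ≈ 1# →
                  ∃ λ x → ∀ α → f α ≈ χ α x
      unique  : ∀ x y → (∀ α → χ α x ≈ χ α y) → x ≡ y

  δ : (M : FinAbGroup) → Carrier M → K₀
  δ M α with FinAbGroup._≟_ M α (FinAbGroup.ε M)
  ... | yes _ = 1#
  ... | no  _ = 0#

  record IsJacobi (M : FinAbGroup) (J : Carrier M → Carrier M → K₀) : Set (c ⊔ ℓ) where
    open FinAbGroup M using (_∙_; _⁻¹)
    J* : Carrier M → Carrier M → K₀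
    J* α β = J α β - δ M α - δ M β
    field
      sym-J  : ∀ α β → J α β ≈ J β α
      cocyc  : ∀ α β γ → J* α β * J* (α ∙ β) γ ≈ J* α (β ∙ γ) * J* β γ
      conv   : ∀ α₁ α₂ α₃ α₄ →
                 sumG M (λ β → J (α₁ ∙ β) (α₂ ∙ (β ⁻¹)) * J (α₃ ∙ β) (α₄ ∙ (β ⁻¹)))
                   ≈ J (α₁ ∙ α₄) (α₂ ∙ α₃)

{-# OPTIONS --safe #-}
-- Write ι′ x = i (x⁻¹). The hypothesis on i says i x = x · ι′ x, and the formula for J says
-- m · J(α, β) = F(α, β) := Σₓ α(i x) β(ι′ x). Orthogonality of characters gives |M̂| = m and
-- J(α, 1) = J(1, α) = J(α, α⁻¹) = δ(α); with these the cocycle identity for J* becomes the same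
-- identity for J, hence for F. Expanding F(α, β) F(αβ, γ) = F(α, βγ) F(β, γ) as sums over pairs
-- (x, y) and inverting the character transform on M³, the two systems
--   (i x · i y, ι′ x · i y, ι′ y) = t      and      (i x, ι′ x · i y, ι′ x · ι′ y) = t
-- have equally many solutions for every t ∈ M̂³. At t = (i 1, i 1, ι′ (i⁻¹ 1)) the first system has
-- exactly one solution while every solution of the second forces i 1 = 1; then at
-- t = (s, s, ι′ (i⁻¹ s)) the same comparison forces s = 1. So M̂ is trivial, and since the cocycle
-- identity for J* at (α, α⁻¹, 1) shows that only α = 1 pairs trivially with M̂, so is M.

module Submission where

open import Defs
open import Level using (Level)
open import Data.Nat using (zero; suc)
open import Data.Fin using (Fin)
import Data.Fin as Fin
open import Data.Fin.Properties using (∀-cons; punchInᵢ≢i)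
open import Data.Product using (_×_; _,_; proj₁; proj₂)
open import Function.Base using (_∘_; case_of_)
open import Function.Bundles using (_↔_; Inverse; Injection; mk↔ₛ′)
open import Function.Properties.Inverse using (↔⇒↣; ↔-trans; ↔-sym)
open import Relation.Binary.PropositionalEquality as ≡ using (_≡_; _≢_)
open import Relation.Nullary using (¬_; Dec; yes; no)
open import Relation.Nullary.Decidable using (_×-dec_; decidable-stable)
open import Relation.Nullary.Negation using (contradiction; ¬¬-map)
open import Algebra.Bundles using (AbelianGroup)
import Algebra.Properties.AbelianGroup as AbelianGroupProperties
import Algebra.Properties.Ring as RingProperties
import Algebra.Properties.Semiring.Sum as SemiringSum
import Algebra.Properties.CommutativeSemigroup as CommutativeSemigroupProperties
import Algebra.Solver.CommutativeMonoid as CommutativeMonoidSolver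
import Relation.Binary.Reasoning.Setoid as SetoidReasoning

open FinAbGroup using (Carrier; order; enum)

abelianGroup : FinAbGroup → AbelianGroup _ _
abelianGroup G = record { isAbelianGroup = FinAbGroup.isAbelianGroup G }

module FinAbGroupProperties (G : FinAbGroup) where
  open AbelianGroup (abelianGroup G) public using (comm; identityˡ; identityʳ; inverseˡ; inverseʳ)
  open AbelianGroupProperties (abelianGroup G) public

¬¬-∀-Fin : ∀ {p} n {P : Fin n → Set p} → (∀ k → ¬ ¬ P k) → ¬ ¬ (∀ k → P k)
¬¬-∀-Fin zero    h k = k (λ ())
¬¬-∀-Fin (suc n) h k =
  h Fin.zero (λ p₀ → ¬¬-∀-Fin n (h ∘ Fin.suc) (λ pₛ → k (∀-cons p₀ pₛ)))

¬¬-∀ : ∀ {p} (G : FinAbGroup) {P : Carrier G → Set p} →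
       (∀ g → ¬ ¬ P g) → ¬ ¬ (∀ g → P g)
¬¬-∀ G {P} h k =
  ¬¬-∀-Fin (order G) (h ∘ to) (λ all → k (λ g → ≡.subst P (to∘from g) (all (from g))))
  where
  open Inverse (enum G) using (to; from) renaming (strictlyInverseˡ to to∘from)

module FieldProperties {c ℓ : Level} (K : Field c ℓ) where
  open Field K renaming (Carrier to K₀)
  open RingProperties ring using (x[y-z]≈xy-xz; +-identityʳ-unique; -‿involutive; -0#≈0#)
  open SetoidReasoning setoid

  *-cancelˡ-≉0 : ∀ {s a b} → ¬ s ≈ 0# → s * a ≈ s * b → a ≈ b
  *-cancelˡ-≉0 {s} {a} {b} s≉0 sa≈sb with inverse s s≉0
  ... | s⁻¹ , ss⁻¹≈1 = begin
    a                ≈⟨ *-identityˡ a ⟨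
    1# * a           ≈⟨ *-congʳ (trans (*-comm s⁻¹ s) ss⁻¹≈1) ⟨
    (s⁻¹ * s) * a    ≈⟨ *-assoc s⁻¹ s a ⟩
    s⁻¹ * (s * a)    ≈⟨ *-congˡ sa≈sb ⟩
    s⁻¹ * (s * b)    ≈⟨ *-assoc s⁻¹ s b ⟨
    (s⁻¹ * s) * b    ≈⟨ *-congʳ (trans (*-comm s⁻¹ s) ss⁻¹≈1) ⟩
    1# * b           ≈⟨ *-identityˡ b ⟩
    b                ∎

  *-≉0 : ∀ {a b} → ¬ a ≈ 0# → ¬ b ≈ 0# → ¬ a * b ≈ 0#
  *-≉0 {a} a≉0 b≉0 ab≈0 = b≉0 (*-cancelˡ-≉0 a≉0 (trans ab≈0 (sym (zeroʳ a))))

  x[y-1]≈xy⇒x≈0 : ∀ x y → x * (y - 1#) ≈ x * y → x ≈ 0#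
  x[y-1]≈xy⇒x≈0 x y eq = begin
    x        ≈⟨ -‿involutive x ⟨
    - (- x)  ≈⟨ -‿cong (+-identityʳ-unique (x * y) (- x) xy-x≈xy) ⟩
    - 0#     ≈⟨ -0#≈0# ⟩
    0#       ∎
    where
    xy-x≈xy : x * y - x ≈ x * y
    xy-x≈xy = begin
      x * y - x       ≈⟨ +-congˡ (-‿cong (*-identityʳ x)) ⟨
      x * y - x * 1#  ≈⟨ x[y-z]≈xy-xz x y 1# ⟨
      x * (y - 1#)    ≈⟨ eq ⟩
      x * y           ∎

  x-0≈x : ∀ x → x - 0# ≈ x
  x-0≈x x = trans (+-congˡ -0#≈0#) (+-identityʳ x)

  x≈0⇒x*y≈0 : ∀ {x} y → x ≈ 0# → x * y ≈ 0#
  x≈0⇒x*y≈0 y x≈0 = trans (*-congʳ x≈0) (zeroˡ y)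

  y≈0⇒x*y≈0 : ∀ x {y} → y ≈ 0# → x * y ≈ 0#
  y≈0⇒x*y≈0 x y≈0 = trans (*-congˡ y≈0) (zeroʳ x)

  indicator : ∀ {p} {P : Set p} → Dec P → K₀
  indicator (yes _) = 1#
  indicator (no _)  = 0#

  indicator-yes : ∀ {p} {P : Set p} (P? : Dec P) → P → indicator P? ≈ 1#
  indicator-yes (yes _) _  = refl
  indicator-yes (no ¬P) pr = contradiction pr ¬P

  indicator-no : ∀ {p} {P : Set p} (P? : Dec P) → ¬ P → indicator P? ≈ 0#
  indicator-no (yes pr) ¬P = contradiction pr ¬P
  indicator-no (no _)   _  = refl

  module _ {p q} {P : Set p} {Q : Set q} where

    indicator-⇔ : (P? : Dec P) (Q? : Dec Q) → (P → Q) → (Q → P) → indicator P? ≈ indicator Q?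
    indicator-⇔ (yes pr) Q? P→Q _ = sym (indicator-yes Q? (P→Q pr))
    indicator-⇔ (no ¬P)  Q? _ Q→P = sym (indicator-no Q? (¬P ∘ Q→P))

    indicator-× : (P? : Dec P) (Q? : Dec Q) → indicator (P? ×-dec Q?) ≈ indicator P? * indicator Q?
    indicator-× (yes _) (yes _) = sym (*-identityˡ 1#)
    indicator-× (yes _) (no _)  = sym (zeroʳ 1#)
    indicator-× (no _)  Q?      = sym (zeroˡ (indicator Q?))

  module _ (G : FinAbGroup) where
    open FinAbGroup G using (ε; _≟_)

    δ-ε : δ K G ε ≈ 1#
    δ-ε with ε ≟ ε
    ... | yes _   = refl
    ... | no ε≢ε = contradiction ≡.refl ε≢ε

    δ-≢ε : ∀ {g} → g ≢ ε → δ K G g ≈ 0#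
    δ-≢ε {g} g≢ε with g ≟ ε
    ... | yes g≡ε = contradiction g≡ε g≢ε
    ... | no _    = refl

    δ-idem : ∀ g → δ K G g * δ K G g ≈ δ K G g
    δ-idem g with g ≟ ε
    ... | yes _ = *-identityˡ 1#
    ... | no _  = zeroˡ 0#

  fromℕ-order≉0 : HasCharZero K → (G : FinAbGroup) → ¬ fromℕ K (order G) ≈ 0#
  fromℕ-order≉0 char0 G = nonempty (Inverse.from (enum G) (FinAbGroup.ε G))
    where
    nonempty : ∀ {n} → Fin n → ¬ fromℕ K n ≈ 0#
    nonempty {suc n} _ = char0 n

module Summation {c ℓ : Level} (K : Field c ℓ) where
  open Field K renaming (Carrier to K₀)
  open FieldProperties K using (indicator; indicator-yes; indicator-no)
  open SemiringSum semiring
    using ( sum; sum-cong-≋; sum-cong-≗; sum-remove; sum-replicate-zero; ∑-comm; sum-permute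
          ; *-distribˡ-sum; *-distribʳ-sum)
  open SetoidReasoning setoid

  private
    sumFin≡sum : ∀ n (f : Fin n → K₀) → sumFin K n f ≡ sum f
    sumFin≡sum zero    f = ≡.refl
    sumFin≡sum (suc n) f = ≡.cong (f Fin.zero +_) (sumFin≡sum n (f ∘ Fin.suc))

    sumFin-1 : ∀ n → sumFin K n (λ _ → 1#) ≈ fromℕ K n
    sumFin-1 zero    = refl
    sumFin-1 (suc n) = +-congˡ (sumFin-1 n)

    sum-single : ∀ {n} (t : Fin n → K₀) k → (∀ j → j ≢ k → t j ≈ 0#) → sum t ≈ t k
    sum-single {suc n} t k t≈0 = begin
      sum t                          ≈⟨ sum-remove {i = k} t ⟩
      t k + sum (t ∘ Fin.punchIn k)  ≈⟨ +-congˡ (sum-cong-≋ (λ j → t≈0 _ (punchInᵢ≢i k j))) ⟩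
      t k + sum {n} (λ _ → 0#)       ≈⟨ +-congˡ (sum-replicate-zero n) ⟩
      t k + 0#                       ≈⟨ +-identityʳ (t k) ⟩
      t k                            ∎

    via-sum : {G H : FinAbGroup} {f : Carrier G → K₀} {g : Carrier H → K₀} →
              sum (f ∘ Inverse.to (enum G)) ≈ sum (g ∘ Inverse.to (enum H)) →
              sumG K G f ≈ sumG K H g
    via-sum {G} {H} {f} {g} eq =
      trans (reflexive (sumFin≡sum (order G) (f ∘ Inverse.to (enum G))))
            (trans eq (reflexive (≡.sym (sumFin≡sum (order H) (g ∘ Inverse.to (enum H))))))

  module OverGroup (G : FinAbGroup) where
    open Inverse (enum G) using (to; from)
      renaming (strictlyInverseˡ to to∘from; strictlyInverseʳ to from∘to)

    private
      sumG≡sum : (f : Carrier G → K₀) → sumG K G f ≡ sum (f ∘ to)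
      sumG≡sum f = sumFin≡sum (order G) (f ∘ to)

    sumG-cong : {f g : Carrier G → K₀} → (∀ x → f x ≈ g x) → sumG K G f ≈ sumG K G g
    sumG-cong {f} {g} f≈g = via-sum {G} {G} {f} {g} (sum-cong-≋ (f≈g ∘ to))

    *-distribˡ-sumG : ∀ a (f : Carrier G → K₀) → a * sumG K G f ≈ sumG K G (λ x → a * f x)
    *-distribˡ-sumG a f = begin
      a * sumG K G f                ≡⟨ ≡.cong (a *_) (sumG≡sum f) ⟩
      a * sum (f ∘ to)              ≈⟨ *-distribˡ-sum a (f ∘ to) ⟩
      sum (λ k → a * f (to k))      ≡⟨ sumG≡sum (λ x → a * f x) ⟨
      sumG K G (λ x → a * f x)      ∎

    *-distribʳ-sumG : ∀ a (f : Carrier G → K₀) → sumG K G f * a ≈ sumG K G (λ x → f x * a)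
    *-distribʳ-sumG a f = begin
      sumG K G f * a                ≡⟨ ≡.cong (_* a) (sumG≡sum f) ⟩
      sum (f ∘ to) * a              ≈⟨ *-distribʳ-sum a (f ∘ to) ⟩
      sum (λ k → f (to k) * a)      ≡⟨ sumG≡sum (λ x → f x * a) ⟨
      sumG K G (λ x → f x * a)      ∎

    sumG-zero : {f : Carrier G → K₀} → (∀ x → f x ≈ 0#) → sumG K G f ≈ 0#
    sumG-zero {f} f≈0 = begin
      sumG K G f               ≈⟨ sumG-cong f≈0 ⟩
      sumG K G (λ _ → 0#)      ≡⟨ sumG≡sum (λ _ → 0#) ⟩
      sum {order G} (λ _ → 0#) ≈⟨ sum-replicate-zero (order G) ⟩
      0#                       ∎

    sumG-single : (f : Carrier G → K₀) (x₀ : Carrier G) → (∀ x → x ≢ x₀ → f x ≈ 0#) →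
                  sumG K G f ≈ f x₀
    sumG-single f x₀ f≈0 = begin
      sumG K G f        ≡⟨ sumG≡sum f ⟩
      sum (f ∘ to)      ≈⟨ sum-single (f ∘ to) (from x₀) (λ k k≢ → f≈0 (to k) (k≢ ∘ to≡x₀⇒)) ⟩
      f (to (from x₀))  ≡⟨ ≡.cong f (to∘from x₀) ⟩
      f x₀              ∎
      where
      to≡x₀⇒ : ∀ {k} → to k ≡ x₀ → k ≡ from x₀
      to≡x₀⇒ {k} eq = ≡.trans (≡.sym (from∘to k)) (≡.cong from eq)

    sumG-1 : sumG K G (λ _ → 1#) ≈ fromℕ K (order G)
    sumG-1 = sumFin-1 (order G)

    sumG-reindex : (π : Carrier G ↔ Carrier G) (f : Carrier G → K₀) →
                   sumG K G f ≈ sumG K G (f ∘ Inverse.to π)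
    sumG-reindex π f = via-sum {G} {G} {f} {f ∘ Inverse.to π} (begin
      sum (f ∘ to)                 ≈⟨ sum-permute (f ∘ to) ρ ⟩
      sum (f ∘ to ∘ Inverse.to ρ)  ≡⟨ sum-cong-≗ (λ k → ≡.cong f (to∘from (Inverse.to π (to k)))) ⟩
      sum (f ∘ Inverse.to π ∘ to)  ∎)
      where
      ρ : Fin (order G) ↔ Fin (order G)
      ρ = ↔-trans (enum G) (↔-trans π (↔-sym (enum G)))

    module _ {p} {P : Carrier G → Set p} (P? : ∀ x → Dec (P x)) where

      sumG-indicator-unique : ∀ {x₀} → P x₀ → (∀ x → P x → x ≡ x₀) →
                              sumG K G (λ x → indicator (P? x)) ≈ 1#
      sumG-indicator-unique {x₀} Px₀ unique =
        trans (sumG-single _ x₀ (λ x x≢x₀ → indicator-no (P? x) (x≢x₀ ∘ unique x)))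
              (indicator-yes (P? x₀) Px₀)

      sumG-indicator-none : (∀ x → ¬ P x) → sumG K G (λ x → indicator (P? x)) ≈ 0#
      sumG-indicator-none ¬P = sumG-zero (λ x → indicator-no (P? x) (¬P x))

  module OverGroups (G H : FinAbGroup) where
    private
      module G = OverGroup G
      module H = OverGroup H

    sumG-comm : (f : Carrier G → Carrier H → K₀) →
                sumG K G (λ x → sumG K H (f x)) ≈ sumG K H (λ y → sumG K G (λ x → f x y))
    sumG-comm f = via-sum {G} {H} {λ x → sumG K H (f x)} {λ y → sumG K G (λ x → f x y)} (begin
      sum (λ k → sumG K H (f (toG k)))
        ≈⟨ sum-cong-≋ (λ k → reflexive (sumFin≡sum (order H) (f (toG k) ∘ toH))) ⟩
      sum (λ k → sum (λ l → f (toG k) (toH l)))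
        ≈⟨ ∑-comm (λ k l → f (toG k) (toH l)) ⟩
      sum (λ l → sum (λ k → f (toG k) (toH l)))
        ≈⟨ sum-cong-≋ (λ l → reflexive (≡.sym (sumFin≡sum (order G) (λ k → f (toG k) (toH l))))) ⟩
      sum (λ l → sumG K G (λ x → f x (toH l)))
        ∎)
      where
      toG : Fin (order G) → Carrier G
      toG = Inverse.to (enum G)
      toH : Fin (order H) → Carrier H
      toH = Inverse.to (enum H)

    sumG-*-sumG : (f : Carrier G → K₀) (g : Carrier H → K₀) →
                  sumG K G f * sumG K H g ≈ sumG K G (λ x → sumG K H (λ y → f x * g y))
    sumG-*-sumG f g = trans (G.*-distribʳ-sumG _ f) (G.sumG-cong (λ x → H.*-distribˡ-sumG (f x) g))

    *-distribˡ-sumG² : ∀ a (f : Carrier G → Carrier H → K₀) →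
                       a * sumG K G (λ x → sumG K H (f x)) ≈
                       sumG K G (λ x → sumG K H (λ y → a * f x y))
    *-distribˡ-sumG² a f = trans (G.*-distribˡ-sumG a (λ x → sumG K H (f x)))
                                 (G.sumG-cong (λ x → H.*-distribˡ-sumG a (f x)))

    *-distribʳ-sumG² : ∀ a (f : Carrier G → Carrier H → K₀) →
                       sumG K G (λ x → sumG K H (f x)) * a ≈
                       sumG K G (λ x → sumG K H (λ y → f x y * a))
    *-distribʳ-sumG² a f = trans (G.*-distribʳ-sumG a (λ x → sumG K H (f x)))
                                 (G.sumG-cong (λ x → H.*-distribʳ-sumG a (f x)))

    module _ {p} {P : Carrier G → Carrier H → Set p} (P? : ∀ x y → Dec (P x y)) where

      sumG²-indicator-unique : ∀ {x₀ y₀} → P x₀ y₀ → (∀ x y → P x y → x ≡ x₀ × y ≡ y₀) →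
                               sumG K G (λ x → sumG K H (λ y → indicator (P? x y))) ≈ 1#
      sumG²-indicator-unique {x₀} {y₀} Px₀y₀ unique =
        trans (G.sumG-single _ x₀ (λ x x≢x₀ →
                 H.sumG-indicator-none (P? x) (λ y → x≢x₀ ∘ proj₁ ∘ unique x y)))
              (H.sumG-indicator-unique (P? x₀) Px₀y₀ (λ y → proj₂ ∘ unique x₀ y))

      sumG²-indicator-none : (∀ x y → ¬ P x y) →
                             sumG K G (λ x → sumG K H (λ y → indicator (P? x y))) ≈ 0#
      sumG²-indicator-none ¬P = G.sumG-zero (λ x → H.sumG-indicator-none (P? x) (¬P x))

  module OverGroups³ (G H L : FinAbGroup) where
    private
      module G = OverGroup G
      module H = OverGroup H
      module L = OverGroup L
      module GH = OverGroups G H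
      module GL = OverGroups G L

    sumG-*-sumG-*-sumG : (f : Carrier G → K₀) (g : Carrier H → K₀) (h : Carrier L → K₀) →
                         (sumG K G f * sumG K H g) * sumG K L h ≈
                         sumG K G (λ x → sumG K H (λ y → sumG K L (λ z → (f x * g y) * h z)))
    sumG-*-sumG-*-sumG f g h = begin
      (sumG K G f * sumG K H g) * sumG K L h
        ≈⟨ *-congʳ (GH.sumG-*-sumG f g) ⟩
      sumG K G (λ x → sumG K H (λ y → f x * g y)) * sumG K L h
        ≈⟨ GH.*-distribʳ-sumG² (sumG K L h) (λ x y → f x * g y) ⟩
      sumG K G (λ x → sumG K H (λ y → (f x * g y) * sumG K L h))
        ≈⟨ G.sumG-cong (λ x → H.sumG-cong (λ y → L.*-distribˡ-sumG (f x * g y) h)) ⟩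
      sumG K G (λ x → sumG K H (λ y → sumG K L (λ z → (f x * g y) * h z)))
        ∎

    sumG-comm² : (f : Carrier G → Carrier H → Carrier L → K₀) →
                 sumG K G (λ x → sumG K H (λ y → sumG K L (f x y))) ≈
                 sumG K H (λ y → sumG K L (λ z → sumG K G (λ x → f x y z)))
    sumG-comm² f = trans (OverGroups.sumG-comm G H (λ x y → sumG K L (f x y)))
                         (H.sumG-cong (λ y → GL.sumG-comm (λ x → f x y)))

translation : (G : FinAbGroup) → Carrier G → Carrier G ↔ Carrier G
translation G g = mk↔ₛ′ (g ∙_) (g ⁻¹ ∙_) (\\-leftDividesˡ g) (\\-leftDividesʳ g)
  where
  open FinAbGroup G using (_∙_; _⁻¹)
  open FinAbGroupProperties G using (\\-leftDividesˡ; \\-leftDividesʳ)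

module Characters {c ℓ : Level} (K : Field c ℓ) (G : FinAbGroup) where
  open Field K renaming (Carrier to K₀)
  open FinAbGroup G using (_∙_)
  open FieldProperties K using (*-cancelˡ-≉0)
  open Summation.OverGroup K G using (sumG-reindex; sumG-cong; *-distribˡ-sumG)
  open SetoidReasoning setoid

  sumG≉0⇒trivial : (ψ : Carrier G → K₀) → (∀ x y → ψ (x ∙ y) ≈ ψ x * ψ y) →
                   ¬ sumG K G ψ ≈ 0# → ∀ g → ψ g ≈ 1#
  sumG≉0⇒trivial ψ ψ-mult Σψ≉0 g = *-cancelˡ-≉0 Σψ≉0 (begin
    Σψ * ψ g                   ≈⟨ *-comm Σψ (ψ g) ⟩
    ψ g * Σψ                   ≈⟨ *-distribˡ-sumG (ψ g) ψ ⟩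
    sumG K G (λ x → ψ g * ψ x) ≈⟨ sumG-cong (λ x → sym (ψ-mult g x)) ⟩
    sumG K G (λ x → ψ (g ∙ x)) ≈⟨ sumG-reindex (translation G g) ψ ⟨
    Σψ                         ≈⟨ *-identityʳ Σψ ⟨
    Σψ * 1#                    ∎)
    where
    Σψ : K₀
    Σψ = sumG K G ψ

module Pairing {c ℓ : Level} (K : Field c ℓ) {M D : FinAbGroup}
               {χ : Carrier M → Carrier D → Field.Carrier K} (dual : IsDual K M D χ) where
  open Field K renaming (Carrier to K₀)
  open IsDual dual using (mult-M; mult-D; unit-M; unit-D; unique)
  open FinAbGroup D using (_∙_; _⁻¹; ε; _≟_)
  open FieldProperties K
  open SetoidReasoning setoid
  private
    module M = FinAbGroup M
    module SM = Summation.OverGroup K M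
    module SD = Summation.OverGroup K D
    module MP = FinAbGroupProperties M
    module DP = FinAbGroupProperties D

  ΣM : (Carrier M → K₀) → K₀
  ΣM = sumG K M

  ΣD : (Carrier D → K₀) → K₀
  ΣD = sumG K D

  m̂ : K₀
  m̂ = fromℕ K (order M)

  χ-⁻¹ : ∀ α y → χ (α M.⁻¹) y * χ α y ≈ 1#
  χ-⁻¹ α y = begin
    χ (α M.⁻¹) y * χ α y  ≈⟨ mult-M (α M.⁻¹) α y ⟨
    χ (α M.⁻¹ M.∙ α) y    ≡⟨ ≡.cong (λ β → χ β y) (MP.inverseˡ α) ⟩
    χ M.ε y               ≈⟨ unit-M y ⟩
    1#                    ∎

  -- Equality in K is not assumed decidable, so orthogonality is only available up to double
  -- negation; this suffices because the final goal α ≡ ε is decidable.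
  ¬¬χ-sum-M : ∀ p → ¬ ¬ (ΣM (λ α → χ α p) ≈ m̂ * indicator (p ≟ ε))
  ¬¬χ-sum-M p with p ≟ ε
  ... | yes ≡.refl = λ ¬sum → ¬sum (begin
    ΣM (λ α → χ α ε)  ≈⟨ SM.sumG-cong unit-D ⟩
    ΣM (λ _ → 1#)     ≈⟨ SM.sumG-1 ⟩
    m̂                 ≈⟨ *-identityʳ m̂ ⟨
    m̂ * 1#            ∎)
  ... | no p≢ε = ¬¬-map (λ sum≈0 → trans sum≈0 (sym (zeroʳ m̂))) (λ sum≉0 → p≢ε (unique p ε (λ α →
    trans (Characters.sumG≉0⇒trivial K M (λ α → χ α p) (λ α β → mult-M α β p) sum≉0 α)
          (sym (unit-D α)))))

  ¬¬χ-sum-D : ∀ α → ¬ (∀ y → χ α y ≈ 1#) → ¬ ¬ (ΣD (χ α) ≈ 0#)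
  ¬¬χ-sum-D α nontrivial sum≉0 = nontrivial (Characters.sumG≉0⇒trivial K D (χ α) (mult-D α) sum≉0)

  D³ : Set
  D³ = Carrier D × Carrier D × Carrier D

  _≐_ : D³ → D³ → Set
  (p , q , r) ≐ (u , v , w) = p ≡ u × q ≡ v × r ≡ w

  _≐?_ : ∀ s t → Dec (s ≐ t)
  (p , q , r) ≐? (u , v , w) = p ≟ u ×-dec q ≟ v ×-dec r ≟ w

  _⁻¹³ : D³ → D³
  (u , v , w) ⁻¹³ = (u ⁻¹ , v ⁻¹ , w ⁻¹)

  χ³ : Carrier M → Carrier M → Carrier M → D³ → K₀
  χ³ α β γ (p , q , r) = (χ α p * χ β q) * χ γ r

  ΣM³ : (Carrier M → Carrier M → Carrier M → K₀) → K₀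
  ΣM³ f = ΣM λ α → ΣM λ β → ΣM λ γ → f α β γ

  transform : (Carrier D → Carrier D → D³) → Carrier M → Carrier M → Carrier M → K₀
  transform a α β γ = ΣD λ x → ΣD λ y → χ³ α β γ (a x y)

  count : (Carrier D → Carrier D → D³) → D³ → K₀
  count a t = ΣD λ x → ΣD λ y → indicator (a x y ≐? t)

  module Inversion (χ-sum : ∀ p → ΣM (λ α → χ α p) ≈ m̂ * indicator (p ≟ ε)) where
    private
      module MMM = Summation.OverGroups³ K M M M
      module MDD = Summation.OverGroups³ K M D D
      module DD = Summation.OverGroups K D D
      open CommutativeMonoidSolver *-commutativeMonoid using (solve; _⊕_; _⊜_)

    m̂³ : K₀
    m̂³ = (m̂ * m̂) * m̂

    χ-sum-shift : ∀ p u → ΣM (λ α → χ α p * χ α (u ⁻¹)) ≈ m̂ * indicator (p ≟ u)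
    χ-sum-shift p u = begin
      ΣM (λ α → χ α p * χ α (u ⁻¹))   ≈⟨ SM.sumG-cong (λ α → sym (mult-D α p (u ⁻¹))) ⟩
      ΣM (λ α → χ α (p ∙ u ⁻¹))       ≈⟨ χ-sum (p ∙ u ⁻¹) ⟩
      m̂ * indicator ((p ∙ u ⁻¹) ≟ ε)  ≈⟨ *-congˡ (indicator-⇔ ((p ∙ u ⁻¹) ≟ ε) (p ≟ u)
                                                   (DP.x∙y⁻¹≈ε⇒x≈y p u) DP.x≈y⇒x∙y⁻¹≈ε) ⟩
      m̂ * indicator (p ≟ u)           ∎

    orthogonality³ : ∀ s t → ΣM³ (λ α β γ → χ³ α β γ s * χ³ α β γ (t ⁻¹³)) ≈ m̂³ * indicator (s ≐? t)
    orthogonality³ (p , q , r) (u , v , w) = begin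
      ΣM³ (λ α β γ → χ³ α β γ (p , q , r) * χ³ α β γ (u ⁻¹ , v ⁻¹ , w ⁻¹))
        ≈⟨ SM.sumG-cong (λ α → SM.sumG-cong (λ β → SM.sumG-cong (λ γ →
             regroup (χ α p) (χ β q) (χ γ r) (χ α (u ⁻¹)) (χ β (v ⁻¹)) (χ γ (w ⁻¹))))) ⟩
      ΣM³ (λ α β γ → (f α * g β) * h γ)
        ≈⟨ MMM.sumG-*-sumG-*-sumG f g h ⟨
      (ΣM f * ΣM g) * ΣM h
        ≈⟨ *-cong (*-cong (χ-sum-shift p u) (χ-sum-shift q v)) (χ-sum-shift r w) ⟩
      (m̂ * indicator (p ≟ u) * (m̂ * indicator (q ≟ v))) * (m̂ * indicator (r ≟ w))
        ≈⟨ solve 4 (λ m a b c → ((m ⊕ a) ⊕ (m ⊕ b)) ⊕ (m ⊕ c) ⊜ ((m ⊕ m) ⊕ m) ⊕ (a ⊕ (b ⊕ c))) refl m̂ _ _ _ ⟩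
      m̂³ * (indicator (p ≟ u) * (indicator (q ≟ v) * indicator (r ≟ w)))
        ≈⟨ *-congˡ (trans (indicator-× (p ≟ u) _) (*-congˡ (indicator-× (q ≟ v) (r ≟ w)))) ⟨
      m̂³ * indicator ((p , q , r) ≐? (u , v , w))
        ∎
      where
      f g h : Carrier M → K₀
      f α = χ α p * χ α (u ⁻¹)
      g β = χ β q * χ β (v ⁻¹)
      h γ = χ γ r * χ γ (w ⁻¹)
      regroup : ∀ a b c a′ b′ c′ → ((a * b) * c) * ((a′ * b′) * c′) ≈ ((a * a′) * (b * b′)) * (c * c′)
      regroup = solve 6 (λ a b c a′ b′ c′ →
        ((a ⊕ b) ⊕ c) ⊕ ((a′ ⊕ b′) ⊕ c′) ⊜ ((a ⊕ a′) ⊕ (b ⊕ b′)) ⊕ (c ⊕ c′)) refl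

    fourier-inversion : ∀ a t → ΣM³ (λ α β γ → transform a α β γ * χ³ α β γ (t ⁻¹³)) ≈ m̂³ * count a t
    fourier-inversion a t = begin
      ΣM³ (λ α β γ → transform a α β γ * χ³ α β γ (t ⁻¹³))
        ≈⟨ SM.sumG-cong (λ α → SM.sumG-cong (λ β → SM.sumG-cong (λ γ →
             DD.*-distribʳ-sumG² (χ³ α β γ (t ⁻¹³)) (λ x y → χ³ α β γ (a x y))))) ⟩
      ΣM³ (λ α β γ → ΣD (λ x → ΣD (λ y → φ α β γ x y)))
        ≈⟨ SM.sumG-cong (λ α → SM.sumG-cong (λ β → MDD.sumG-comm² (φ α β))) ⟩
      ΣM (λ α → ΣM (λ β → ΣD (λ x → ΣD (λ y → ΣM (λ γ → φ α β γ x y)))))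
        ≈⟨ SM.sumG-cong (λ α → MDD.sumG-comm² (λ β x y → ΣM (λ γ → φ α β γ x y))) ⟩
      ΣM (λ α → ΣD (λ x → ΣD (λ y → ΣM (λ β → ΣM (λ γ → φ α β γ x y)))))
        ≈⟨ MDD.sumG-comm² (λ α x y → ΣM (λ β → ΣM (λ γ → φ α β γ x y))) ⟩
      ΣD (λ x → ΣD (λ y → ΣM³ (λ α β γ → φ α β γ x y)))
        ≈⟨ SD.sumG-cong (λ x → SD.sumG-cong (λ y → orthogonality³ (a x y) t)) ⟩
      ΣD (λ x → ΣD (λ y → m̂³ * indicator (a x y ≐? t)))
        ≈⟨ DD.*-distribˡ-sumG² m̂³ (λ x y → indicator (a x y ≐? t)) ⟨
      m̂³ * count a t
        ∎
      where
      φ : Carrier M → Carrier M → Carrier M → Carrier D → Carrier D → K₀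
      φ α β γ x y = χ³ α β γ (a x y) * χ³ α β γ (t ⁻¹³)

    count-determined : ¬ m̂ ≈ 0# → ∀ {a b} → (∀ α β γ → transform a α β γ ≈ transform b α β γ) →
                       ∀ t → count a t ≈ count b t
    count-determined m̂≉0 {a} {b} a≈b t = *-cancelˡ-≉0 m̂³≉0 (begin
      m̂³ * count a t
        ≈⟨ fourier-inversion a t ⟨
      ΣM³ (λ α β γ → transform a α β γ * χ³ α β γ (t ⁻¹³))
        ≈⟨ SM.sumG-cong (λ α → SM.sumG-cong (λ β → SM.sumG-cong (λ γ →
             *-congʳ {x = χ³ α β γ (t ⁻¹³)} (a≈b α β γ)))) ⟩
      ΣM³ (λ α β γ → transform b α β γ * χ³ α β γ (t ⁻¹³))
        ≈⟨ fourier-inversion b t ⟩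
      m̂³ * count b t
        ∎)
      where
      m̂³≉0 : ¬ m̂³ ≈ 0#
      m̂³≉0 = *-≉0 (*-≉0 m̂≉0 m̂≉0) m̂≉0

module Jacobi {c ℓ : Level} (K : Field c ℓ) (char0 : HasCharZero K)
  (M D : FinAbGroup) (χ : Carrier M → Carrier D → Field.Carrier K) (dual : IsDual K M D χ)
  (J : Carrier M → Carrier M → Field.Carrier K) (jacobi : IsJacobi K M J)
  (i : Carrier D ↔ Carrier D)
  (i-inv : ∀ x → Inverse.to i x ≡ FinAbGroup._∙_ D x (Inverse.to i (FinAbGroup._⁻¹ D x)))
  (J-formula : ∀ α β → Field._≈_ K (Field._*_ K (fromℕ K (FinAbGroup.order M)) (J α β))
      (sumG K D (λ x → Field._*_ K (χ α (Inverse.to i x))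
        (χ β (FinAbGroup._∙_ D (Inverse.to i x) (FinAbGroup._⁻¹ D x))))))
  where
  open Field K renaming (Carrier to K₀)
  open FieldProperties K
  open Pairing K dual
  open IsDual dual using (mult-M; mult-D; unit-M; unit-D)
  open FinAbGroup D using (_∙_; _⁻¹; ε; _≟_)
  open IsJacobi jacobi using (J*; sym-J; cocyc)
  open SetoidReasoning setoid
  private
    module M = FinAbGroup M
    module SM = Summation.OverGroup K M
    module SD = Summation.OverGroup K D
    module MD = Summation.OverGroups K M D
    module DD = Summation.OverGroups K D D
    module MP = FinAbGroupProperties M
    module DP = FinAbGroupProperties D
    open CommutativeMonoidSolver *-commutativeMonoid using (solve; _⊕_; _⊜_)

  ι ι′ : Carrier D → Carrier D
  ι     = Inverse.to i
  ι′ x  = ι (x ⁻¹)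

  ι-injective : ∀ {x y} → ι x ≡ ι y → x ≡ y
  ι-injective = Injection.injective (↔⇒↣ i)

  ι′-injective : ∀ {x y} → ι′ x ≡ ι′ y → x ≡ y
  ι′-injective = DP.⁻¹-injective ∘ ι-injective

  ι′-ε : ι′ ε ≡ ι ε
  ι′-ε = ≡.cong ι DP.ε⁻¹≈ε

  ι′≡ι⇒≡ε : ∀ {x} → ι′ x ≡ ι x → x ≡ ε
  ι′≡ι⇒≡ε {x} ι′x≡ιx =
    DP.identityˡ-unique x (ι x) (≡.trans (≡.cong (x ∙_) (≡.sym ι′x≡ιx)) (≡.sym (i-inv x)))

  F : Carrier M → Carrier M → K₀
  F α β = ΣD (λ x → χ α (ι x) * χ β (ι′ x))

  n̂ : K₀
  n̂ = fromℕ K (order D)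

  m̂≉0 : ¬ m̂ ≈ 0#
  m̂≉0 = fromℕ-order≉0 char0 M

  n̂≉0 : ¬ n̂ ≈ 0#
  n̂≉0 = fromℕ-order≉0 char0 D

  m̂J≈F : ∀ α β → m̂ * J α β ≈ F α β
  m̂J≈F α β =
    trans (J-formula α β) (SD.sumG-cong (λ x → *-congˡ {x = χ α (ι x)} (reflexive (≡.cong (χ β) (ι∙⁻¹ x)))))
    where
    ι∙⁻¹ : ∀ x → ι x ∙ x ⁻¹ ≡ ι′ x
    ι∙⁻¹ x = ≡.trans (≡.cong (_∙ x ⁻¹) (i-inv x)) (DP.xyx⁻¹≈y x (ι′ x))

  J*≈J : ∀ {α β} → α ≢ M.ε → β ≢ M.ε → J* α β ≈ J α β
  J*≈J {α} {β} α≢ε β≢ε =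
    trans (+-cong (trans (+-congˡ (-‿cong (δ-≢ε M α≢ε))) (x-0≈x (J α β))) (-‿cong (δ-≢ε M β≢ε)))
          (x-0≈x (J α β))

  χ-trivial⇒≡ε : ∀ α → (∀ y → χ α y ≈ 1#) → α ≡ M.ε
  χ-trivial⇒≡ε α α-trivial = decidable-stable (α M.≟ M.ε) (λ α≢ε → n̂≉0 (n̂≈0 α≢ε))
    where
    a : K₀
    a = J M.ε M.ε

    m̂J≈n̂ : ∀ {β γ} → (∀ y → χ β y ≈ 1#) → (∀ y → χ γ y ≈ 1#) → m̂ * J β γ ≈ n̂
    m̂J≈n̂ {β} {γ} β-trivial γ-trivial = trans (m̂J≈F β γ) (trans (SD.sumG-cong summand≈1) SD.sumG-1)
      where
      summand≈1 : ∀ x → χ β (ι x) * χ γ (ι′ x) ≈ 1#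
      summand≈1 x = trans (*-cong (β-trivial (ι x)) (γ-trivial (ι′ x))) (*-identityˡ 1#)

    J≈a : ∀ {β γ} → (∀ y → χ β y ≈ 1#) → (∀ y → χ γ y ≈ 1#) → J β γ ≈ a
    J≈a β-trivial γ-trivial =
      *-cancelˡ-≉0 m̂≉0 (trans (m̂J≈n̂ β-trivial γ-trivial) (sym (m̂J≈n̂ unit-M unit-M)))

    α⁻¹-trivial : ∀ y → χ (α M.⁻¹) y ≈ 1#
    α⁻¹-trivial y = trans (sym (*-identityʳ _)) (trans (*-congˡ (sym (α-trivial y))) (χ-⁻¹ α y))

    n̂≈0 : α ≢ M.ε → n̂ ≈ 0#
    n̂≈0 α≢ε = trans (sym (m̂J≈n̂ unit-M unit-M)) (y≈0⇒x*y≈0 m̂ a≈0)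
      where
      α⁻¹≢ε : α M.⁻¹ ≢ M.ε
      α⁻¹≢ε α⁻¹≡ε = α≢ε (MP.⁻¹-injective (≡.trans α⁻¹≡ε (≡.sym MP.ε⁻¹≈ε)))

      J*αα⁻¹≈a : J* α (α M.⁻¹) ≈ a
      J*αα⁻¹≈a = trans (J*≈J α≢ε α⁻¹≢ε) (J≈a α-trivial α⁻¹-trivial)

      -- the cocycle identity at (α, α⁻¹, 1) reads a (a - 2) = a (a - 1)
      a≈0 : a ≈ 0#
      a≈0 = x[y-1]≈xy⇒x≈0 a (a - 1#) (begin
        a * ((a - 1#) - 1#)                      ≈⟨ *-cong J*αα⁻¹≈a J*εε≈a-1-1 ⟨
        J* α (α M.⁻¹) * J* M.ε M.ε               ≡⟨ ≡.cong (λ g → J* α (α M.⁻¹) * J* g M.ε) (MP.inverseʳ α) ⟨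
        J* α (α M.⁻¹) * J* (α M.∙ α M.⁻¹) M.ε    ≈⟨ cocyc α (α M.⁻¹) M.ε ⟩
        J* α (α M.⁻¹ M.∙ M.ε) * J* (α M.⁻¹) M.ε  ≡⟨ ≡.cong (λ g → J* α g * J* (α M.⁻¹) M.ε) (MP.identityʳ _) ⟩
        J* α (α M.⁻¹) * J* (α M.⁻¹) M.ε          ≈⟨ *-cong J*αα⁻¹≈a J*α⁻¹ε≈a-1 ⟩
        a * (a - 1#)                             ∎)
        where
        J*εε≈a-1-1 : J* M.ε M.ε ≈ (a - 1#) - 1#
        J*εε≈a-1-1 = +-cong (+-congˡ (-‿cong (δ-ε M))) (-‿cong (δ-ε M))

        J*α⁻¹ε≈a-1 : J* (α M.⁻¹) M.ε ≈ a - 1#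
        J*α⁻¹ε≈a-1 =
          +-cong (trans (+-cong (J≈a α⁻¹-trivial unit-M) (-‿cong (δ-≢ε M α⁻¹≢ε))) (x-0≈x a)) (-‿cong (δ-ε M))

  module Orthogonal (χ-sum-M : ∀ p → ΣM (λ α → χ α p) ≈ m̂ * indicator (p ≟ ε))
                    (χ-sum-D : ∀ α → α ≢ M.ε → ΣD (χ α) ≈ 0#) where
    open Inversion χ-sum-M

    n̂≈m̂ : n̂ ≈ m̂
    n̂≈m̂ = begin
      n̂                                 ≈⟨ SD.sumG-1 ⟨
      ΣD (λ _ → 1#)                     ≈⟨ SD.sumG-cong unit-M ⟨
      ΣD (χ M.ε)                        ≈⟨ SM.sumG-single (λ α → ΣD (χ α)) M.ε χ-sum-D ⟨
      ΣM (λ α → ΣD (χ α))               ≈⟨ MD.sumG-comm χ ⟩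
      ΣD (λ y → ΣM (λ α → χ α y))       ≈⟨ SD.sumG-cong χ-sum-M ⟩
      ΣD (λ y → m̂ * indicator (y ≟ ε))  ≈⟨ SD.*-distribˡ-sumG m̂ (λ y → indicator (y ≟ ε)) ⟨
      m̂ * ΣD (λ y → indicator (y ≟ ε))  ≈⟨ *-congˡ (SD.sumG-indicator-unique (_≟ ε) ≡.refl (λ _ y≡ε → y≡ε)) ⟩
      m̂ * 1#                            ≈⟨ *-identityʳ m̂ ⟩
      m̂                                 ∎

    χ-sum-D≈m̂δ : ∀ α → ΣD (χ α) ≈ m̂ * δ K M α
    χ-sum-D≈m̂δ α with α M.≟ M.ε
    ... | yes ≡.refl = trans (SD.sumG-cong unit-M) (trans SD.sumG-1 (trans n̂≈m̂ (sym (*-identityʳ m̂))))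
    ... | no α≢ε     = trans (χ-sum-D α α≢ε) (sym (zeroʳ m̂))

    J-εʳ : ∀ α → J α M.ε ≈ δ K M α
    J-εʳ α = *-cancelˡ-≉0 m̂≉0 (begin
      m̂ * J α M.ε    ≈⟨ m̂J≈F α M.ε ⟩
      F α M.ε        ≈⟨ SD.sumG-cong {g = χ α ∘ ι} (λ x → trans (*-congˡ (unit-M (ι′ x))) (*-identityʳ _)) ⟩
      ΣD (χ α ∘ ι)   ≈⟨ SD.sumG-reindex i (χ α) ⟨
      ΣD (χ α)       ≈⟨ χ-sum-D≈m̂δ α ⟩
      m̂ * δ K M α    ∎)

    J-εˡ : ∀ β → J M.ε β ≈ δ K M β
    J-εˡ β = trans (sym-J M.ε β) (J-εʳ β)

    J-⁻¹ : ∀ α → J α (α M.⁻¹) ≈ δ K M α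
    J-⁻¹ α = *-cancelˡ-≉0 m̂≉0 (begin
      m̂ * J α (α M.⁻¹)  ≈⟨ m̂J≈F α (α M.⁻¹) ⟩
      F α (α M.⁻¹)      ≈⟨ SD.sumG-cong summand ⟩
      ΣD (χ α)          ≈⟨ χ-sum-D≈m̂δ α ⟩
      m̂ * δ K M α       ∎)
      where
      summand : ∀ x → χ α (ι x) * χ (α M.⁻¹) (ι′ x) ≈ χ α x
      summand x = begin
        χ α (ι x) * χ (α M.⁻¹) (ι′ x)              ≡⟨ ≡.cong (λ y → χ α y * χ (α M.⁻¹) (ι′ x)) (i-inv x) ⟩
        χ α (x ∙ ι′ x) * χ (α M.⁻¹) (ι′ x)         ≈⟨ *-congʳ (mult-D α x (ι′ x)) ⟩
        (χ α x * χ α (ι′ x)) * χ (α M.⁻¹) (ι′ x)   ≈⟨ *-assoc _ _ _ ⟩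
        χ α x * (χ α (ι′ x) * χ (α M.⁻¹) (ι′ x))   ≈⟨ *-congˡ (trans (*-comm _ _) (χ-⁻¹ α (ι′ x))) ⟩
        χ α x * 1#                                 ≈⟨ *-identityʳ _ ⟩
        χ α x                                      ∎

    J-vanishes : ∀ {α β} → α ≢ M.ε → α M.∙ β ≡ M.ε → J α β ≈ 0#
    J-vanishes {α} α≢ε αβ≡ε =
      trans (reflexive (≡.cong (J α) (MP.inverseʳ-unique α _ αβ≡ε))) (trans (J-⁻¹ α) (δ-≢ε M α≢ε))

    CocycleAt : Carrier M → Carrier M → Carrier M → Set ℓ
    CocycleAt α β γ = J α β * J (α M.∙ β) γ ≈ J α (β M.∙ γ) * J β γ

    cocycle-reflect : ∀ {α β γ} → CocycleAt α β γ → CocycleAt γ β α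
    cocycle-reflect {α} {β} {γ} αβγ = begin
      J γ β * J (γ M.∙ β) α  ≡⟨ ≡.cong (λ g → J γ β * J g α) (MP.comm γ β) ⟩
      J γ β * J (β M.∙ γ) α  ≈⟨ *-cong (sym-J γ β) (sym-J _ α) ⟩
      J β γ * J α (β M.∙ γ)  ≈⟨ *-comm _ _ ⟩
      J α (β M.∙ γ) * J β γ  ≈⟨ αβγ ⟨
      J α β * J (α M.∙ β) γ  ≈⟨ *-comm _ _ ⟩
      J (α M.∙ β) γ * J α β  ≈⟨ *-cong (sym-J _ γ) (sym-J α β) ⟩
      J γ (α M.∙ β) * J β α  ≡⟨ ≡.cong (λ g → J γ g * J β α) (MP.comm α β) ⟩
      J γ (β M.∙ α) * J β α  ∎

    cocycle-εˡ : ∀ β γ → CocycleAt M.ε β γ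
    cocycle-εˡ β γ with β M.≟ M.ε
    ... | yes ≡.refl = begin
      J M.ε M.ε * J (M.ε M.∙ M.ε) γ  ≡⟨ ≡.cong (λ g → J M.ε M.ε * J g γ) (MP.identityˡ M.ε) ⟩
      J M.ε M.ε * J M.ε γ            ≈⟨ *-cong (trans (J-εˡ M.ε) (δ-ε M)) (J-εˡ γ) ⟩
      1# * δ K M γ                   ≈⟨ *-identityˡ _ ⟩
      δ K M γ                        ≈⟨ δ-idem M γ ⟨
      δ K M γ * δ K M γ              ≈⟨ *-cong (J-εˡ γ) (J-εˡ γ) ⟨
      J M.ε γ * J M.ε γ              ≡⟨ ≡.cong (λ g → J M.ε g * J M.ε γ) (MP.identityˡ γ) ⟨
      J M.ε (M.ε M.∙ γ) * J M.ε γ    ∎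
    ... | no β≢ε = trans (x≈0⇒x*y≈0 _ (trans (J-εˡ β) (δ-≢ε M β≢ε))) (sym rhs≈0)
      where
      rhs≈0 : J M.ε (β M.∙ γ) * J β γ ≈ 0#
      rhs≈0 with (β M.∙ γ) M.≟ M.ε
      ... | yes βγ≡ε = y≈0⇒x*y≈0 _ (J-vanishes β≢ε βγ≡ε)
      ... | no βγ≢ε  = x≈0⇒x*y≈0 _ (trans (J-εˡ _) (δ-≢ε M βγ≢ε))

    cocycle-εᵐ : ∀ {α γ} → α ≢ M.ε → γ ≢ M.ε → CocycleAt α M.ε γ
    cocycle-εᵐ α≢ε γ≢ε = trans (x≈0⇒x*y≈0 _ (trans (J-εʳ _) (δ-≢ε M α≢ε)))
                               (sym (y≈0⇒x*y≈0 _ (trans (J-εˡ _) (δ-≢ε M γ≢ε))))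

    J*-product : ∀ {α β γ} → α ≢ M.ε → β ≢ M.ε → γ ≢ M.ε →
                 J α β * J (α M.∙ β) γ ≈ J* α β * J* (α M.∙ β) γ
    J*-product {α} {β} {γ} α≢ε β≢ε γ≢ε = case (α M.∙ β) M.≟ M.ε of λ where
      (yes αβ≡ε) → trans (x≈0⇒x*y≈0 _ (J-vanishes α≢ε αβ≡ε))
                         (sym (x≈0⇒x*y≈0 _ (trans (J*≈J α≢ε β≢ε) (J-vanishes α≢ε αβ≡ε))))
      (no αβ≢ε)  → sym (*-cong (J*≈J α≢ε β≢ε) (J*≈J αβ≢ε γ≢ε))

    J*-sym : ∀ α β → J* α β ≈ J* β α
    J*-sym α β = trans (+-congʳ (+-congʳ (sym-J α β))) (xy∙z≈xz∙y (J β α) _ _)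
      where open CommutativeSemigroupProperties +-commutativeSemigroup using (xy∙z≈xz∙y)

    cocycle-≢ε : ∀ {α β γ} → α ≢ M.ε → β ≢ M.ε → γ ≢ M.ε → CocycleAt α β γ
    cocycle-≢ε {α} {β} {γ} α≢ε β≢ε γ≢ε = begin
      J α β * J (α M.∙ β) γ      ≈⟨ J*-product α≢ε β≢ε γ≢ε ⟩
      J* α β * J* (α M.∙ β) γ    ≈⟨ cocyc α β γ ⟩
      J* α (β M.∙ γ) * J* β γ    ≈⟨ trans (*-comm _ _) (*-congˡ (J*-sym α _)) ⟩
      J* β γ * J* (β M.∙ γ) α    ≈⟨ J*-product β≢ε γ≢ε α≢ε ⟨
      J β γ * J (β M.∙ γ) α      ≈⟨ trans (*-comm _ _) (*-congʳ (sym-J _ α)) ⟩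
      J α (β M.∙ γ) * J β γ      ∎

    J-cocycle : ∀ α β γ → CocycleAt α β γ
    J-cocycle α β γ with α M.≟ M.ε | γ M.≟ M.ε | β M.≟ M.ε
    ... | yes ≡.refl | _          | _          = cocycle-εˡ β γ
    ... | no _       | yes ≡.refl | _          = cocycle-reflect (cocycle-εˡ β α)
    ... | no α≢ε     | no γ≢ε     | yes ≡.refl = cocycle-εᵐ α≢ε γ≢ε
    ... | no α≢ε     | no γ≢ε     | no β≢ε     = cocycle-≢ε α≢ε β≢ε γ≢ε

    F-cocycle : ∀ α β γ → F α β * F (α M.∙ β) γ ≈ F α (β M.∙ γ) * F β γ
    F-cocycle α β γ = begin
      F α β * F (α M.∙ β) γ                ≈⟨ *-cong (m̂J≈F α β) (m̂J≈F _ γ) ⟨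
      (m̂ * J α β) * (m̂ * J (α M.∙ β) γ)    ≈⟨ interchange m̂ _ m̂ _ ⟩
      (m̂ * m̂) * (J α β * J (α M.∙ β) γ)    ≈⟨ *-congˡ (J-cocycle α β γ) ⟩
      (m̂ * m̂) * (J α (β M.∙ γ) * J β γ)    ≈⟨ interchange m̂ m̂ _ _ ⟩
      (m̂ * J α (β M.∙ γ)) * (m̂ * J β γ)    ≈⟨ *-cong (m̂J≈F α _) (m̂J≈F β γ) ⟩
      F α (β M.∙ γ) * F β γ                ∎
      where open CommutativeSemigroupProperties *-commutativeSemigroup using (interchange)

    lhs-pattern rhs-pattern : Carrier D → Carrier D → D³
    lhs-pattern x y = (ι x ∙ ι y , ι′ x ∙ ι y , ι′ y)
    rhs-pattern x y = (ι x , ι′ x ∙ ι y , ι′ x ∙ ι′ y)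

    F-product-lhs : ∀ α β γ → F α β * F (α M.∙ β) γ ≈ transform lhs-pattern α β γ
    F-product-lhs α β γ = trans (DD.sumG-*-sumG f g) (SD.sumG-cong (λ x → SD.sumG-cong (summand x)))
      where
      f g : Carrier D → K₀
      f x = χ α (ι x) * χ β (ι′ x)
      g y = χ (α M.∙ β) (ι y) * χ γ (ι′ y)

      summand : ∀ x y → f x * g y ≈ χ³ α β γ (lhs-pattern x y)
      summand x y = begin
        (χ α (ι x) * χ β (ι′ x)) * (χ (α M.∙ β) (ι y) * χ γ (ι′ y))
          ≈⟨ *-congˡ (*-congʳ (mult-M α β (ι y))) ⟩
        (χ α (ι x) * χ β (ι′ x)) * ((χ α (ι y) * χ β (ι y)) * χ γ (ι′ y))
          ≈⟨ solve 5 (λ a b a′ b′ c → (a ⊕ b) ⊕ ((a′ ⊕ b′) ⊕ c) ⊜ ((a ⊕ a′) ⊕ (b ⊕ b′)) ⊕ c) refl _ _ _ _ _ ⟩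
        ((χ α (ι x) * χ α (ι y)) * (χ β (ι′ x) * χ β (ι y))) * χ γ (ι′ y)
          ≈⟨ *-congʳ (*-cong (mult-D α _ _) (mult-D β _ _)) ⟨
        χ³ α β γ (lhs-pattern x y)
          ∎

    F-product-rhs : ∀ α β γ → F α (β M.∙ γ) * F β γ ≈ transform rhs-pattern α β γ
    F-product-rhs α β γ = trans (DD.sumG-*-sumG f g) (SD.sumG-cong (λ x → SD.sumG-cong (summand x)))
      where
      f g : Carrier D → K₀
      f x = χ α (ι x) * χ (β M.∙ γ) (ι′ x)
      g y = χ β (ι y) * χ γ (ι′ y)

      summand : ∀ x y → f x * g y ≈ χ³ α β γ (rhs-pattern x y)
      summand x y = begin
        (χ α (ι x) * χ (β M.∙ γ) (ι′ x)) * (χ β (ι y) * χ γ (ι′ y))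
          ≈⟨ *-congʳ (*-congˡ (mult-M β γ (ι′ x))) ⟩
        (χ α (ι x) * (χ β (ι′ x) * χ γ (ι′ x))) * (χ β (ι y) * χ γ (ι′ y))
          ≈⟨ solve 5 (λ a b c b′ c′ → (a ⊕ (b ⊕ c)) ⊕ (b′ ⊕ c′) ⊜ (a ⊕ (b ⊕ b′)) ⊕ (c ⊕ c′)) refl _ _ _ _ _ ⟩
        (χ α (ι x) * (χ β (ι′ x) * χ β (ι y))) * (χ γ (ι′ x) * χ γ (ι′ y))
          ≈⟨ *-cong (*-congˡ (mult-D β _ _)) (mult-D γ _ _) ⟨
        χ³ α β γ (rhs-pattern x y)
          ∎

    count-lhs≈count-rhs : ∀ t → count lhs-pattern t ≈ count rhs-pattern t
    count-lhs≈count-rhs = count-determined m̂≉0 {lhs-pattern} {rhs-pattern} (λ α β γ →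
      trans (sym (F-product-lhs α β γ)) (trans (F-cocycle α β γ) (F-product-rhs α β γ)))

    rhs-solvable : ∀ {t x₀ y₀} → lhs-pattern x₀ y₀ ≐ t →
                   (∀ x y → lhs-pattern x y ≐ t → x ≡ x₀ × y ≡ y₀) →
                   ¬ (∀ x y → ¬ rhs-pattern x y ≐ t)
    rhs-solvable {t} lhs-solution lhs-unique no-rhs-solution = 1≉0 (begin
      1#                   ≈⟨ DD.sumG²-indicator-unique (λ x y → lhs-pattern x y ≐? t) lhs-solution lhs-unique ⟨
      count lhs-pattern t  ≈⟨ count-lhs≈count-rhs t ⟩
      count rhs-pattern t  ≈⟨ DD.sumG²-indicator-none (λ x y → rhs-pattern x y ≐? t) no-rhs-solution ⟩
      0#                   ∎)

    -- At (ι ε, ι ε, ι′ d) with ι d = ε the lhs system has the single solution (ε, d).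
    ι-ε : ι ε ≡ ε
    ι-ε = decidable-stable (ιε ≟ ε) (λ ιε≢ε →
      rhs-solvable lhs-solution lhs-unique (λ x y rhs-solution → ιε≢ε (ιε≡ε x y rhs-solution)))
      where
      ιε d : Carrier D
      ιε = ι ε
      d  = Inverse.from i ε

      ιd≡ε : ι d ≡ ε
      ιd≡ε = Inverse.strictlyInverseˡ i ε

      lhs-solution : lhs-pattern ε d ≐ (ιε , ιε , ι′ d)
      lhs-solution = ≡.trans (≡.cong (ιε ∙_) ιd≡ε) (DP.identityʳ ιε)
                   , ≡.trans (≡.cong₂ _∙_ ι′-ε ιd≡ε) (DP.identityʳ ιε)
                   , ≡.refl

      lhs-unique : ∀ x y → lhs-pattern x y ≐ (ιε , ιε , ι′ d) → x ≡ ε × y ≡ d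
      lhs-unique x y (e₁ , _ , e₃) = ι-injective ιx≡ιε , y≡d
        where
        y≡d : y ≡ d
        y≡d = ι′-injective e₃
        ιx≡ιε : ι x ≡ ιε
        ιx≡ιε = ≡.trans (≡.sym (DP.identityʳ (ι x)))
                        (≡.trans (≡.cong (ι x ∙_) (≡.sym (≡.trans (≡.cong ι y≡d) ιd≡ε))) e₁)

      ιε≡ε : ∀ x y → rhs-pattern x y ≐ (ιε , ιε , ι′ d) → ιε ≡ ε
      ιε≡ε x y (e₁ , e₂ , e₃) = DP.identityˡ-unique ιε (ι′ d) ιε∙ι′d≡ι′d
        where
        ι′x≡ιε : ι′ x ≡ ιε
        ι′x≡ιε = ≡.trans (≡.cong ι′ (ι-injective e₁)) ι′-ε
        ιy≡ε : ι y ≡ ε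
        ιy≡ε = DP.identityʳ-unique ιε (ι y) (≡.trans (≡.cong (_∙ ι y) (≡.sym ι′x≡ιε)) e₂)
        y≡d : y ≡ d
        y≡d = ι-injective (≡.trans ιy≡ε (≡.sym ιd≡ε))
        ιε∙ι′d≡ι′d : ιε ∙ ι′ d ≡ ι′ d
        ιε∙ι′d≡ι′d = ≡.trans (≡.cong₂ _∙_ (≡.sym ι′x≡ιε) (≡.cong ι′ (≡.sym y≡d))) e₃

    -- At (s, s, ι′ y₁) with ι y₁ = s the lhs system has the single solution (ε, y₁).
    D-trivial : ∀ s → s ≡ ε
    D-trivial s = decidable-stable (s ≟ ε) (λ s≢ε →
      rhs-solvable lhs-solution lhs-unique (λ x y rhs-solution → s≢ε (s≡ε x y rhs-solution)))
      where
      y₁ : Carrier D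
      y₁ = Inverse.from i s

      ιy₁≡s : ι y₁ ≡ s
      ιy₁≡s = Inverse.strictlyInverseˡ i s

      ι′ε≡ε : ι′ ε ≡ ε
      ι′ε≡ε = ≡.trans ι′-ε ι-ε

      lhs-solution : lhs-pattern ε y₁ ≐ (s , s , ι′ y₁)
      lhs-solution = ≡.trans (≡.cong₂ _∙_ ι-ε ιy₁≡s) (DP.identityˡ s)
                   , ≡.trans (≡.cong₂ _∙_ ι′ε≡ε ιy₁≡s) (DP.identityˡ s)
                   , ≡.refl

      lhs-unique : ∀ x y → lhs-pattern x y ≐ (s , s , ι′ y₁) → x ≡ ε × y ≡ y₁
      lhs-unique x y (e₁ , _ , e₃) = ι-injective (≡.trans ιx≡ε (≡.sym ι-ε)) , y≡y₁
        where
        y≡y₁ : y ≡ y₁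
        y≡y₁ = ι′-injective e₃
        ιx≡ε : ι x ≡ ε
        ιx≡ε = DP.identityˡ-unique (ι x) s
                 (≡.trans (≡.cong (ι x ∙_) (≡.sym (≡.trans (≡.cong ι y≡y₁) ιy₁≡s))) e₁)

      s≡ε : ∀ x y → rhs-pattern x y ≐ (s , s , ι′ y₁) → s ≡ ε
      s≡ε x y (e₁ , e₂ , e₃) = ≡.trans (≡.sym ιy₁≡s) (≡.trans (≡.cong ι y₁≡ε) ι-ε)
        where
        x≡y₁ : x ≡ y₁
        x≡y₁ = ι-injective (≡.trans e₁ (≡.sym ιy₁≡s))
        ι′y≡ε : ι′ y ≡ ε
        ι′y≡ε = DP.identityʳ-unique (ι′ y₁) (ι′ y) (≡.trans (≡.cong (λ z → ι′ z ∙ ι′ y) (≡.sym x≡y₁)) e₃)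
        ιy≡ε : ι y ≡ ε
        ιy≡ε = ≡.trans (≡.cong ι (ι′-injective (≡.trans ι′y≡ε (≡.sym ι′ε≡ε)))) ι-ε
        ι′y₁≡s : ι′ y₁ ≡ s
        ι′y₁≡s = ≡.trans (≡.sym (DP.identityʳ (ι′ y₁)))
                         (≡.trans (≡.cong₂ _∙_ (≡.cong ι′ (≡.sym x≡y₁)) (≡.sym ιy≡ε)) e₂)
        y₁≡ε : y₁ ≡ ε
        y₁≡ε = ι′≡ι⇒≡ε (≡.trans ι′y₁≡s (≡.sym ιy₁≡s))

    M-trivial : ∀ α → α ≡ M.ε
    M-trivial α = χ-trivial⇒≡ε α (λ y → trans (reflexive (≡.cong (χ α) (D-trivial y))) (unit-D α))

  M-trivial : ∀ α → α ≡ M.ε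
  M-trivial α = decidable-stable (α M.≟ M.ε) (λ α≢ε →
    ¬¬-∀ D ¬¬χ-sum-M (λ sum-M →
    ¬¬-∀ M ¬¬χ-sum-D′ (λ sum-D →
    α≢ε (Orthogonal.M-trivial sum-M sum-D α))))
    where
    ¬¬χ-sum-D′ : ∀ β → ¬ ¬ (β ≢ M.ε → ΣD (χ β) ≈ 0#)
    ¬¬χ-sum-D′ β with β M.≟ M.ε
    ... | yes β≡ε = λ ¬sum → ¬sum (λ β≢ε → contradiction β≡ε β≢ε)
    ... | no β≢ε  = ¬¬-map (λ sum≈0 _ → sum≈0) (¬¬χ-sum-D β (β≢ε ∘ χ-trivial⇒≡ε β))

proposition6p1 : {c ℓ : Level} (K : Field c ℓ) → IsAlgClosed K → HasCharZero K →
    (M D : FinAbGroup) (χ : FinAbGroup.Carrier M → FinAbGroup.Carrier D → Field.Carrier K) →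
    IsDual K M D χ →
    (J : FinAbGroup.Carrier M → FinAbGroup.Carrier M → Field.Carrier K) → IsJacobi K M J →
    (i : FinAbGroup.Carrier D ↔ FinAbGroup.Carrier D) →
    (∀ x → Inverse.to i x ≡ FinAbGroup._∙_ D x (Inverse.to i (FinAbGroup._⁻¹ D x))) →
    (∀ α β → Field._≈_ K (Field._*_ K (fromℕ K (FinAbGroup.order M)) (J α β))
      (sumG K D (λ x → Field._*_ K (χ α (Inverse.to i x))
        (χ β (FinAbGroup._∙_ D (Inverse.to i x) (FinAbGroup._⁻¹ D x)))))) →
    ∀ α → α ≡ FinAbGroup.ε M
proposition6p1 K _ char0 M D χ dual J jacobi i i-inv J-formula =
  Jacobi.M-trivial K char0 M D χ dual J jacobi i i-inv J-formula
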